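{- Let $\mathcal{C} \subseteq \mathbb{F}_q^{k \times m}$ be a code with $|\mathcal{C}| \ge 2$. Then $\mu(\mathcal{C}) = d(\mathcal{C}) - \min\{\rho(\mathcal{C}),\, d(\mathcal{C})\}$. In particular, if $\mathcal{C}$ is maximal then $\mu(\mathcal{C}) = d(\mathcal{C}) - \rho(\mathcal{C})$.
   Context: $q$ is a prime power, $k \le m$ are positive integers, and $\mathbb{F}_q^{k\times m}$ is the space of $k\times m$ matrices over $\mathbb{F}_q$. The rank distance is $d(M,N) = \mathrm{rk}(M-N)$. A code is a non-empty subset $\mathcal{C}\subseteq \mathbb{F}_q^{k\times m}$; if $|\mathcal{C}|\ge 2$ its minimum distance is $d(\mathcal{C}) = \min\{d(M,N): M,N\in\mathcal{C}, M\ne N\}$. The covering radius is $\rho(\mathcal{C}) = \min\{ i : \text{for all } X \in \mathbb{F}_q^{k\times m} \text{ there is } M\in\mathcal{C} \text{ with } d(X,M)\le i\}$. A code $\mathcal{C}$ is maximal if $|\mathcal{C}|=1$, or $|\mathcal{C}|\ge 2$ and there is no code $\mathcal{D}\supsetneq \mathcal{C}$ with $d(\mathcal{D}) = d(\mathcal{C})$. For $|\mathcal{C}|\ge 2$ the maximality degree is $\mu(\mathcal{C}) = \min\{ d(\mathcal{C}) - d(\mathcal{D}) : \mathcal{D}\subseteq \mathbb{F}_q^{k\times m} \text{ a code with } \mathcal{D}\supsetneq\mathcal{C}\}$ if $\mathcal{C}\ne \mathbb{F}_q^{k\times m}$, and $\mu(\mathcal{C}) = 1$ if $\mathcal{C}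 = \mathbb{F}_q^{k\times m}$. -}

module Defs where

open import Level using (0ℓ)
open import Data.Nat using (ℕ; zero; suc; _≤_; _<_; _^_)
open import Data.Nat.Primality using (Prime)
open import Data.Fin using (Fin)
open import Data.Vec using (Vec; []; _∷_; zipWith; map; replicate)
open import Data.Bool using (Bool; true; false)
open import Data.Product using (Σ; ∃; ∃-syntax; _×_; _,_)
open import Data.Sum using (_⊎_)
open import Function.Bundles using (_↔_)
open import Function.Definitions using (Injective)
open import Relation.Nullary using (¬_)
open import Relation.Binary.PropositionalEquality using (_≡_; _≢_)
open import Algebra.Structures using (IsCommutativeRing)

IsPrimePower : ℕ → Set
IsPrimePower q = ∃[ p ] ∃[ e ] (Prime p × q ≡ p ^ suc e)

record FiniteField : Set₁ where
  field
    F : Set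
    _+_ _*_ : F → F → F
    -_ : F → F
    0# 1# : F
    isCommutativeRing : IsCommutativeRing _≡_ _+_ _*_ -_ 0# 1#
    0≢1 : 0# ≢ 1#
    inverse : ∀ x → x ≢ 0# → ∃[ y ] (x * y ≡ 1#)
    q : ℕ
    q-primePower : IsPrimePower q
    card : F ↔ Fin q

module Codes (𝔽 : FiniteField) (k m : ℕ) where
  open FiniteField 𝔽

  Matrix : Set
  Matrix = Vec (Vec F m) k

  _-ₘ_ : Matrix → Matrix → Matrix
  M -ₘ N = zipWith (zipWith (λ a b → a + (- b))) M N

  zeroRow : Vec F m
  zeroRow = replicate m 0#

  rowAdd : Vec F m → Vec F m → Vec F m
  rowAdd = zipWith _+_

  scale : F → Vec F m → Vec F m
  scale c v = map (c *_) v

  row : Matrix → Fin k → Vec F m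
  row M i = Data.Vec.lookup M i

  linComb : (r : ℕ) → Matrix → (Fin r → Fin k) → (Fin r → F) → Vec F m
  linComb zero M sel c = zeroRow
  linComb (suc r) M sel c =
    rowAdd (scale (c Fin.zero) (row M (sel Fin.zero)))
           (linComb r M (λ j → sel (Fin.suc j)) (λ j → c (Fin.suc j)))
    where import Data.Fin as Fin

  LinIndepRows : Matrix → (r : ℕ) → (Fin r → Fin k) → Set
  LinIndepRows M r sel =
    Injective _≡_ _≡_ sel ×
    (∀ (c : Fin r → F) → linComb r M sel c ≡ zeroRow → ∀ j → c j ≡ 0#)

  IsRank : Matrix → ℕ → Set
  IsRank M r =
    (Σ (Fin r → Fin k) λ sel → LinIndepRows M r sel) ×
    (∀ r' (sel : Fin r' → Fin k) → LinIndepRows M r' sel → r' ≤ r)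

  Dist : Matrix → Matrix → ℕ → Set
  Dist M N r = IsRank (M -ₘ N) r

  Code : Set
  Code = Matrix → Bool

  _∈_ : Matrix → Code → Set
  M ∈ C = C M ≡ true

  NonEmpty : Code → Set
  NonEmpty C = ∃[ M ] (M ∈ C)

  AtLeastTwo : Code → Set
  AtLeastTwo C = ∃[ M ] ∃[ N ] (M ∈ C × N ∈ C × M ≢ N)

  MinDist : Code → ℕ → Set
  MinDist C d =
    (∃[ M ] ∃[ N ] (M ∈ C × N ∈ C × M ≢ N × Dist M N d)) ×
    (∀ M N r → M ∈ C → N ∈ C → M ≢ N → Dist M N r → d ≤ r)

  Covers : Code → ℕ → Set
  Covers C i = ∀ X → ∃[ M ] ∃[ r ] (M ∈ C × Dist X M r × r ≤ i)

  CovRad : Code → ℕ → Set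
  CovRad C ρ = Covers C ρ × (∀ i → Covers C i → ρ ≤ i)

  ProperSuperset : Code → Code → Set
  ProperSuperset D C = (∀ X → X ∈ C → X ∈ D) × (∃[ X ] (X ∈ D × C X ≡ false))

  Full : Code → Set
  Full C = ∀ X → X ∈ C

  Maximal : Code → Set
  Maximal C =
    (NonEmpty C × ¬ AtLeastTwo C) ⊎
    (AtLeastTwo C × (∀ D d → ProperSuperset D C → MinDist C d → ¬ MinDist D d))

  MaxDeg : Code → ℕ → Set
  MaxDeg C μ =
    (Full C × μ ≡ 1) ⊎
    (¬ Full C ×
     (∃[ D ] ∃[ dC ] ∃[ dD ]
        (ProperSuperset D C × MinDist C dC × MinDist D dD × μ ≡ dC Data.Nat.∸ dD)) ×
     (∀ D dC dD → ProperSuperset D C → MinDist C dC → MinDist D dD → μ ≤ dC Data.Nat.∸ dD))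

module Submission where

-- Every proper superset D of C contains a word Y ∉ C; Y lies within ρ(C)
-- of a codeword, and D still contains a pair of codewords at distance d(C), so
-- d(D) ≤ min{ρ(C), d(C)}.  Conversely, if C is not the whole space, minimality
-- of ρ(C) yields a word X at distance ≥ ρ(C) from every codeword, and C ∪ {X}
-- has minimum distance exactly min{ρ(C), d(C)}.  The whole space has ρ = 0 and
-- d = 1, matching the convention μ = 1.  A maximal code cannot be enlarged
-- without losing distance, which forces ρ(C) ≤ d(C) and gives the second claim.

open import Defs
open import Level using (0ℓ)
open import Data.Nat using (ℕ; zero; suc; _≤_; _<_; _∸_; _⊓_; z≤n; s≤s)
import Data.Nat.Properties as ℕ
open import Data.Fin using (Fin; zero; suc; fromℕ<)
import Data.Fin.Properties as Fin
open import Data.Vec using (Vec; []; _∷_; lookup; tabulate; replicate; zipWith; map; _[_]≔_)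
import Data.Vec.Properties as Vec
open import Data.Bool using (true; false; _∨_)
import Data.Bool.Properties as Bool
open import Data.Product using (∃; ∃-syntax; _×_; _,_; proj₁; proj₂)
open import Data.Sum using (_⊎_; inj₁; inj₂)
open import Function.Base using (_∘_)
open import Function.Bundles using (_↔_; Inverse)
open import Function.Definitions using (Injective)
open import Function.Properties.Inverse using (↔⇒↣)
open import Relation.Nullary using (¬_; Dec; yes; no; ¬?; does; contradiction; decidable-stable)
open import Relation.Nullary.Decidable using (map′; via-injection; _→-dec_; _×-dec_)
open import Relation.Unary using (Pred; Decidable)
open import Relation.Binary.Definitions using (DecidableEquality)
open import Relation.Binary.PropositionalEquality
open import Algebra.Bundles using (Ring)
open import Algebra.Structures using (IsCommutativeRing)
import Algebra.Properties.Ring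

-- Finite types are exhaustible; this is what makes rank, distance,
-- minimum distance and covering radius computable below.
Exhaustible : Set → Set₁
Exhaustible A = ∀ {P : Pred A 0ℓ} → Decidable P → Dec (∃ P)

Respects≗ : {A : Set} {n : ℕ} → Pred (Fin n → A) 0ℓ → Set
Respects≗ P = ∀ {f g} → (∀ i → f i ≡ g i) → P f → P g

exhaustible-Fin : ∀ n → Exhaustible (Fin n)
exhaustible-Fin n = Fin.any?

∀-dec : {A : Set} → Exhaustible A → {P : Pred A 0ℓ} → Decidable P → Dec (∀ x → P x)
∀-dec exh P? with exh (λ x → ¬? (P? x))
... | yes (x , ¬px) = no λ all → ¬px (all x)
... | no ∄¬ = yes λ x → decidable-stable (P? x) λ ¬px → ∄¬ (x , ¬px)

module _ {A : Set} where

  exhaustible-↔ : {B : Set} → A ↔ B → Exhaustible B → Exhaustible A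
  exhaustible-↔ A↔B exh {P} P? =
    map′ (λ (b , p) → from b , p)
         (λ (x , p) → to x , subst P (sym (strictlyInverseʳ x)) p)
         (exh (λ b → P? (from b)))
    where open Inverse A↔B

  exhaustible-Vec : Exhaustible A → ∀ n → Exhaustible (Vec A n)
  exhaustible-Vec exh zero P? = map′ (λ p → [] , p) (λ { ([] , p) → p }) (P? [])
  exhaustible-Vec exh (suc n) P? =
    map′ (λ (x , xs , p) → x ∷ xs , p) (λ { (x ∷ xs , p) → x , xs , p })
         (exh (λ x → exhaustible-Vec exh n (λ xs → P? (x ∷ xs))))

  module _ {n : ℕ} {P : Pred (Fin n → A) 0ℓ} (resp : Respects≗ P) (P? : Decidable P)
           (exh : Exhaustible A) where

    ∃-fun-dec : Dec (∃ P)
    ∃-fun-dec =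
      map′ (λ (v , p) → lookup v , p)
           (λ (f , p) → tabulate f , resp (λ i → sym (Vec.lookup∘tabulate f i)) p)
           (exhaustible-Vec exh n (λ v → P? (lookup v)))

    ∀-fun-dec : Dec (∀ f → P f)
    ∀-fun-dec =
      map′ (λ all f → resp (Vec.lookup∘tabulate f) (all (tabulate f)))
           (λ all v → all (lookup v))
           (∀-dec (exhaustible-Vec exh n) (λ v → P? (lookup v)))

Least : Pred ℕ 0ℓ → ℕ → Set
Least P n = P n × (∀ r → P r → n ≤ r)

Greatest : Pred ℕ 0ℓ → ℕ → Set
Greatest P n = P n × (∀ r → P r → r ≤ n)

module _ {P : Pred ℕ 0ℓ} (P? : Decidable P) where

  least-or-absent : ∀ n → ∃ (Least P) ⊎ (∀ r → r < n → ¬ P r)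
  least-or-absent zero = inj₂ λ _ ()
  least-or-absent (suc n) with least-or-absent n
  ... | inj₁ found = inj₁ found
  ... | inj₂ absent with P? n
  ...   | yes pn = inj₁ (n , pn , λ r pr → ℕ.≮⇒≥ λ r<n → absent r r<n pr)
  ...   | no ¬pn = inj₂ λ r r<1+n → case (ℕ.m<1+n⇒m<n∨m≡n r<1+n)
    where
    case : ∀ {r} → r < n ⊎ r ≡ n → ¬ P r
    case (inj₁ r<n) = absent _ r<n
    case (inj₂ refl) = ¬pn

  least : ∀ {n} → P n → ∃ (Least P)
  least {n} pn with least-or-absent (suc n)
  ... | inj₁ found = found
  ... | inj₂ absent = contradiction pn (absent n ℕ.≤-refl)

  greatest : ∀ {w} → P w → ∀ B → (∀ r → P r → r ≤ B) → ∃ (Greatest P)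
  greatest pw zero bound = zero , subst P (ℕ.n≤0⇒n≡0 (bound _ pw)) pw , bound
  greatest pw (suc B) bound with P? (suc B)
  ... | yes pB = suc B , pB , bound
  ... | no ¬pB = greatest pw B λ r pr →
          ℕ.≤-pred (ℕ.≤∧≢⇒< (bound r pr) λ { refl → ¬pB pr })

module FieldFacts (𝔽 : FiniteField) where
  open FiniteField 𝔽
  open IsCommutativeRing isCommutativeRing
    using (isRing; zeroˡ; zeroʳ; +-identityʳ; -‿inverseʳ; *-assoc; *-identityʳ)

  private
    ring : Ring 0ℓ 0ℓ
    ring = record { isRing = isRing }
    module R = Algebra.Properties.Ring ring

  _≟F_ : DecidableEquality F
  _≟F_ = via-injection (↔⇒↣ card) Fin._≟_

  exhaustible-F : Exhaustible F
  exhaustible-F = exhaustible-↔ card (exhaustible-Fin q)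

  _-F_ : F → F → F
  a -F b = a + (- b)

  -F-zero⇒≡ : ∀ a b → a -F b ≡ 0# → a ≡ b
  -F-zero⇒≡ = R.x∙y⁻¹≈ε⇒x≈y

  -‿zero⇒zero : ∀ c → - c ≡ 0# → c ≡ 0#
  -‿zero⇒zero c e = R.-‿injective (trans e (sym R.-0#≈0#))

  cancel-nonzero : ∀ c a → c * a ≡ 0# → a ≢ 0# → c ≡ 0#
  cancel-nonzero c a ca≡0 a≢0 with inverse a a≢0
  ... | (a⁻¹ , aa⁻¹≡1) = begin
    c                ≡⟨ sym (*-identityʳ c) ⟩
    c * 1#           ≡⟨ cong (c *_) (sym aa⁻¹≡1) ⟩
    c * (a * a⁻¹)    ≡⟨ sym (*-assoc c a a⁻¹) ⟩
    (c * a) * a⁻¹    ≡⟨ cong (_* a⁻¹) ca≡0 ⟩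
    0# * a⁻¹         ≡⟨ zeroˡ a⁻¹ ⟩
    0#               ∎
    where open ≡-Reasoning

  module _ {n : ℕ} where

    0ᵛ : Vec F n
    0ᵛ = replicate n 0#

    scale-zeroˡ : ∀ (v : Vec F n) → map (0# *_) v ≡ 0ᵛ
    scale-zeroˡ v = trans (Vec.map-cong zeroˡ v) (Vec.map-const v 0#)

    scale-zeroʳ : ∀ c → map (c *_) 0ᵛ ≡ 0ᵛ
    scale-zeroʳ c = trans (Vec.map-replicate (c *_) 0# n) (cong (replicate n) (zeroʳ c))

    add-zeroʳ : ∀ (u : Vec F n) → zipWith _+_ u 0ᵛ ≡ u
    add-zeroʳ u = trans (Vec.zipWith-replicate₂ _+_ u 0#)
                        (trans (Vec.map-cong +-identityʳ u) (Vec.map-id u))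

    sub-zeroʳ : ∀ (u : Vec F n) → zipWith _-F_ u 0ᵛ ≡ u
    sub-zeroʳ u = trans (Vec.zipWith-replicate₂ _-F_ u 0#)
                        (trans (Vec.map-cong (λ a → trans (cong (a +_) R.-0#≈0#) (+-identityʳ a)) u)
                               (Vec.map-id u))

    neg-involutive : ∀ (v : Vec F n) → map -_ (map -_ v) ≡ v
    neg-involutive v = trans (sym (Vec.map-∘ -_ -_ v)) (trans (Vec.map-cong R.-‿involutive v) (Vec.map-id v))

    scale-neg : ∀ c (v : Vec F n) → map (c *_) (map -_ v) ≡ map ((- c) *_) v
    scale-neg c v = trans (sym (Vec.map-∘ (c *_) -_ v))
                          (Vec.map-cong (λ a → trans (sym (R.-‿distribʳ-* c a)) (R.-‿distribˡ-* c a)) v)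

  ones-nonzero : ∀ {n} → 1 ≤ n → replicate n 1# ≢ 0ᵛ
  ones-nonzero (s≤s _) e = 0≢1 (sym (Vec.∷-injectiveˡ e))

  sub-zero⇒≡ : ∀ {n} (u v : Vec F n) → zipWith _-F_ u v ≡ 0ᵛ → u ≡ v
  sub-zero⇒≡ [] [] _ = refl
  sub-zero⇒≡ (a ∷ u) (b ∷ v) e =
    cong₂ _∷_ (-F-zero⇒≡ a b (Vec.∷-injectiveˡ e)) (sub-zero⇒≡ u v (Vec.∷-injectiveʳ e))

  sub-swap : ∀ {n} (u v : Vec F n) → zipWith _-F_ v u ≡ map -_ (zipWith _-F_ u v)
  sub-swap [] [] = refl
  sub-swap (a ∷ u) (b ∷ v) = cong₂ _∷_ (sym (R.⁻¹-anti-homo‿- a b)) (sub-swap u v)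

  sub-self : ∀ {n} (v : Vec F n) → zipWith _-F_ v v ≡ 0ᵛ
  sub-self [] = refl
  sub-self (a ∷ v) = cong₂ _∷_ (-‿inverseʳ a) (sub-self v)

  scale-nonzero : ∀ {n} c (v : Vec F n) → map (c *_) v ≡ 0ᵛ → v ≢ 0ᵛ → c ≡ 0#
  scale-nonzero c [] _ v≢0 = contradiction refl v≢0
  scale-nonzero c (a ∷ v) cv≡0 v≢0 with a ≟F 0#
  ... | no a≢0 = cancel-nonzero c a (Vec.∷-injectiveˡ cv≡0) a≢0
  ... | yes refl = scale-nonzero c v (Vec.∷-injectiveʳ cv≡0) (λ v≡0 → v≢0 (cong (0# ∷_) v≡0))

module RankDistance (𝔽 : FiniteField) (k m : ℕ) where
  open FiniteField 𝔽
  open Codes 𝔽 k m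
  open FieldFacts 𝔽

  exhaustible-Matrix : Exhaustible Matrix
  exhaustible-Matrix = exhaustible-Vec (exhaustible-Vec exhaustible-F m) k

  _≟R_ : DecidableEquality (Vec F m)
  _≟R_ = Vec.≡-dec _≟F_

  _≟M_ : DecidableEquality Matrix
  _≟M_ = Vec.≡-dec _≟R_

  rows-ext : ∀ {M N : Matrix} → (∀ i → row M i ≡ row N i) → M ≡ N
  rows-ext {M} {N} same = begin
    M                 ≡⟨ sym (Vec.tabulate∘lookup M) ⟩
    tabulate (row M)  ≡⟨ Vec.tabulate-cong same ⟩
    tabulate (row N)  ≡⟨ Vec.tabulate∘lookup N ⟩
    N                 ∎
    where open ≡-Reasoning

  linComb-cong : ∀ r A {s s' : Fin r → Fin k} {c c' : Fin r → F} →
                 (∀ j → s j ≡ s' j) → (∀ j → c j ≡ c' j) → linComb r A s c ≡ linComb r A s' c'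
  linComb-cong zero A _ _ = refl
  linComb-cong (suc r) A s≗s' c≗c' =
    cong₂ rowAdd (cong₂ scale (c≗c' zero) (cong (row A) (s≗s' zero)))
                 (linComb-cong r A (s≗s' ∘ suc) (c≗c' ∘ suc))

  -- Linear independence of a selected family of rows is decidable: injectivity
  -- is a finite check, and there are finitely many coefficient vectors.
  LinIndepRows-dec : ∀ A r s → Dec (LinIndepRows A r s)
  LinIndepRows-dec A r s = injective? ×-dec ∀-fun-dec respects coefficients? exhaustible-F
    where
    injective? : Dec (Injective _≡_ _≡_ s)
    injective? = map′ (λ inj {x} {y} → inj x y) (λ inj x y → inj)
      (∀-dec (exhaustible-Fin r) λ x → ∀-dec (exhaustible-Fin r) λ y →
         (s x Fin.≟ s y) →-dec (x Fin.≟ y))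
    Trivial : (Fin r → F) → Set
    Trivial c = linComb r A s c ≡ zeroRow → ∀ j → c j ≡ 0#
    coefficients? : ∀ c → Dec (Trivial c)
    coefficients? c = (linComb r A s c ≟R zeroRow) →-dec ∀-dec (exhaustible-Fin r) (λ j → c j ≟F 0#)
    respects : Respects≗ Trivial
    respects c≗c' trivial e j =
      trans (sym (c≗c' j)) (trivial (trans (linComb-cong r A (λ _ → refl) c≗c') e) j)

  HasIndependentRows : Matrix → ℕ → Set
  HasIndependentRows A r = ∃ (LinIndepRows A r)

  HasIndependentRows-dec : ∀ A r → Dec (HasIndependentRows A r)
  HasIndependentRows-dec A r = ∃-fun-dec respects (LinIndepRows-dec A r) (exhaustible-Fin k)
    where
    respects : Respects≗ (LinIndepRows A r)
    respects s≗s' (inj , trivial) =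
      (λ {x} {y} e → inj (trans (s≗s' x) (trans e (sym (s≗s' y))))) ,
      (λ c e → trivial c (trans (linComb-cong r A s≗s' (λ _ → refl)) e))

  -- Every matrix has a rank: the largest size of an independent family of rows,
  -- which exists since the empty family is independent and families have size ≤ k.
  rank-exists : ∀ A → ∃ (IsRank A)
  rank-exists A with greatest (HasIndependentRows-dec A) empty k size≤k
    where
    empty : HasIndependentRows A 0
    empty = (λ ()) , (λ { {()} }) , λ _ _ ()
    size≤k : ∀ r → HasIndependentRows A r → r ≤ k
    size≤k r (_ , inj , _) = Fin.injective⇒≤ inj
  ... | r , family , largest = r , family , λ r' s' indep → largest r' (s' , indep)

  rank-unique : ∀ {A r r'} → IsRank A r → IsRank A r' → r ≡ r'
  rank-unique ((s , indep) , largest) ((s' , indep') , largest') =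
    ℕ.≤-antisym (largest' _ s indep) (largest _ s' indep')

  rank≤k : ∀ {A r} → IsRank A r → r ≤ k
  rank≤k ((_ , inj , _) , _) = Fin.injective⇒≤ inj

  linComb-vanishing : ∀ r A (s : Fin r → Fin k) (c : Fin r → F) →
                      (∀ j → c j ≡ 0# ⊎ row A (s j) ≡ zeroRow) → linComb r A s c ≡ zeroRow
  linComb-vanishing zero A s c _ = refl
  linComb-vanishing (suc r) A s c vanishes =
    trans (cong₂ rowAdd (term (vanishes zero)) (linComb-vanishing r A (s ∘ suc) (c ∘ suc) (vanishes ∘ suc)))
          (add-zeroʳ zeroRow)
    where
    term : c zero ≡ 0# ⊎ row A (s zero) ≡ zeroRow → scale (c zero) (row A (s zero)) ≡ zeroRow
    term (inj₁ c≡0) = trans (cong (λ a → scale a (row A (s zero))) c≡0) (scale-zeroˡ _)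
    term (inj₂ row≡0) = trans (cong (scale (c zero)) row≡0) (scale-zeroʳ _)

  -- An independent family contains no zero row: its indicator combination would vanish.
  independent⇒nonzero : ∀ {A r s} → LinIndepRows A r s → ∀ j → row A (s j) ≢ zeroRow
  independent⇒nonzero {A} {r} {s} (_ , trivial) j row≡0 =
    0≢1 (trans (sym (trivial δ (linComb-vanishing r A s δ δ-vanishing) j)) δ-self)
    where
    δ : Fin r → F
    δ j' with j' Fin.≟ j
    ... | yes _ = 1#
    ... | no _ = 0#
    δ-self : δ j ≡ 1#
    δ-self with j Fin.≟ j
    ... | yes _ = refl
    ... | no j≢j = contradiction refl j≢j
    δ-vanishing : ∀ j' → δ j' ≡ 0# ⊎ row A (s j') ≡ zeroRow
    δ-vanishing j' with j' Fin.≟ j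
    ... | yes refl = inj₂ row≡0
    ... | no _ = inj₁ refl

  rank-zero : ∀ {A r} → (∀ i → row A i ≡ zeroRow) → IsRank A r → r ≡ 0
  rank-zero {r = zero} _ _ = refl
  rank-zero {r = suc r} zeros ((s , indep) , _) =
    contradiction (zeros (s zero)) (independent⇒nonzero indep zero)

  -- A matrix with at most one nonzero row (row i₀) has rank at most 1: two distinct
  -- rows of an independent family cannot both be row i₀.
  rank-single-row : ∀ {A r} i₀ → (∀ i → i ≢ i₀ → row A i ≡ zeroRow) → IsRank A r → r ≤ 1
  rank-single-row {r = zero} _ _ _ = z≤n
  rank-single-row {r = suc zero} _ _ _ = s≤s z≤n
  rank-single-row {r = suc (suc r)} i₀ zeros ((s , indep) , _) with s zero Fin.≟ i₀
  ... | no s₀≢i₀ = contradiction (zeros _ s₀≢i₀) (independent⇒nonzero indep zero)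
  ... | yes s₀≡i₀ = contradiction (zeros _ s₁≢i₀) (independent⇒nonzero indep (suc zero))
    where
    s₁≢i₀ : s (suc zero) ≢ i₀
    s₁≢i₀ s₁≡i₀ = Fin.0≢1+n (proj₁ indep (trans s₀≡i₀ (sym s₁≡i₀)))

  -- A single nonzero row is an independent family, so such a matrix has rank ≥ 1.
  rank-positive : ∀ {A r} i → row A i ≢ zeroRow → IsRank A r → 1 ≤ r
  rank-positive {A} i nonzero (_ , largest) = largest 1 (λ _ → i) ((λ { {zero} {zero} _ → refl }) , trivial)
    where
    trivial : ∀ c → linComb 1 A (λ _ → i) c ≡ zeroRow → ∀ j → c j ≡ 0#
    trivial c e zero = scale-nonzero (c zero) (row A i) (trans (sym (add-zeroʳ _)) e) nonzero

  module _ {A B : Matrix} (negated : ∀ i → row B i ≡ map -_ (row A i)) where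

    linComb-negated : ∀ r s c → linComb r B s c ≡ linComb r A s (-_ ∘ c)
    linComb-negated zero s c = refl
    linComb-negated (suc r) s c =
      cong₂ rowAdd (trans (cong (scale (c zero)) (negated (s zero))) (scale-neg (c zero) _))
                   (linComb-negated r (s ∘ suc) (c ∘ suc))

    independent-negated : ∀ {r s} → LinIndepRows A r s → LinIndepRows B r s
    independent-negated {r} {s} (inj , trivial) = inj , λ c e j →
      -‿zero⇒zero (c j) (trivial (-_ ∘ c) (trans (sym (linComb-negated r s c)) e) j)

  rank-negated : ∀ {A B r} → (∀ i → row B i ≡ map -_ (row A i)) → IsRank A r → IsRank B r
  rank-negated {A} {B} negated ((s , indep) , largest) =
    (s , independent-negated negated indep) ,
    λ r' s' indep' → largest r' s' (independent-negated negated⁻¹ indep')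
    where
    negated⁻¹ : ∀ i → row A i ≡ map -_ (row B i)
    negated⁻¹ i = trans (sym (neg-involutive (row A i))) (cong (map -_) (sym (negated i)))

  row-diff : ∀ M N i → row (M -ₘ N) i ≡ zipWith _-F_ (row M i) (row N i)
  row-diff M N i = Vec.lookup-zipWith _ i M N

  dist-exists : ∀ M N → ∃ (Dist M N)
  dist-exists M N = rank-exists (M -ₘ N)

  dist≤-dec : ∀ M N i → Dec (∃ λ r → Dist M N r × r ≤ i)
  dist≤-dec M N i with dist-exists M N
  ... | r , d with r ℕ.≤? i
  ...   | yes r≤i = yes (r , d , r≤i)
  ...   | no r≰i = no λ (r' , d' , r'≤i) → r≰i (subst (_≤ i) (rank-unique d' d) r'≤i)

  dist-dec : ∀ M N r → Dec (Dist M N r)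
  dist-dec M N r with dist-exists M N
  ... | r₀ , d with r ℕ.≟ r₀
  ...   | yes refl = yes d
  ...   | no r≢r₀ = no λ d' → r≢r₀ (rank-unique d' d)

  dist-refl : ∀ X → Dist X X 0
  dist-refl X with dist-exists X X
  ... | r , d = subst (Dist X X) (rank-zero (λ i → trans (row-diff X X i) (sub-self _)) d) d

  dist-positive : ∀ {M N r} → M ≢ N → Dist M N r → 1 ≤ r
  dist-positive {M} {N} M≢N d with Fin.any? (λ i → ¬? (row (M -ₘ N) i ≟R zeroRow))
  ... | yes (i , nonzero) = rank-positive i nonzero d
  ... | no allZero = contradiction (rows-ext same) M≢N
    where
    same : ∀ i → row M i ≡ row N i
    same i = sub-zero⇒≡ _ _ (trans (sym (row-diff M N i))
               (decidable-stable (_ ≟R _) λ nonzero → allZero (i , nonzero)))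

  dist-sym : ∀ {M N r} → Dist M N r → Dist N M r
  dist-sym {M} {N} = rank-negated λ i → begin
    row (N -ₘ M) i                          ≡⟨ row-diff N M i ⟩
    zipWith _-F_ (row N i) (row M i)        ≡⟨ sub-swap (row M i) (row N i) ⟩
    map -_ (zipWith _-F_ (row M i) (row N i)) ≡⟨ cong (map -_) (sym (row-diff M N i)) ⟩
    map -_ (row (M -ₘ N) i)                 ∎
    where open ≡-Reasoning

  -- For k, m ≥ 1 there are two matrices at distance ≤ 1: the zero matrix and the
  -- matrix whose row i₀ is all ones and whose other rows vanish.
  rank-one-pair : 1 ≤ k → 1 ≤ m → ∃ λ M → ∃ λ N → M ≢ N × (∀ {r} → Dist M N r → r ≤ 1)
  rank-one-pair 1≤k 1≤m = E , O , E≢O , rank-single-row i₀ other-rows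
    where
    i₀ : Fin k
    i₀ = fromℕ< 1≤k
    O E : Matrix
    O = replicate k zeroRow
    E = O [ i₀ ]≔ replicate m 1#
    E≢O : E ≢ O
    E≢O E≡O = ones-nonzero 1≤m (begin
      replicate m 1#   ≡⟨ sym (Vec.lookup∘update i₀ O _) ⟩
      row E i₀         ≡⟨ cong (λ M → row M i₀) E≡O ⟩
      row O i₀         ≡⟨ Vec.lookup-replicate i₀ zeroRow ⟩
      zeroRow          ∎)
      where open ≡-Reasoning
    other-rows : ∀ i → i ≢ i₀ → row (E -ₘ O) i ≡ zeroRow
    other-rows i i≢i₀ = begin
      row (E -ₘ O) i                  ≡⟨ row-diff E O i ⟩
      zipWith _-F_ (row E i) (row O i) ≡⟨ cong (zipWith _-F_ (row E i)) (Vec.lookup-replicate i zeroRow) ⟩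
      zipWith _-F_ (row E i) zeroRow  ≡⟨ sub-zeroʳ (row E i) ⟩
      row E i                         ≡⟨ Vec.lookup∘update′ i≢i₀ O _ ⟩
      row O i                         ≡⟨ Vec.lookup-replicate i zeroRow ⟩
      zeroRow                         ∎
      where open ≡-Reasoning

module CodeFacts (𝔽 : FiniteField) (k m : ℕ) (C : Codes.Code 𝔽 k m) where
  open Codes 𝔽 k m
  open RankDistance 𝔽 k m

  _∈C? : ∀ M → Dec (M ∈ C)
  M ∈C? = C M Bool.≟ true

  outside-distinct : ∀ {X M} → C X ≡ false → M ∈ C → X ≢ M
  outside-distinct X∉C M∈C refl = contradiction (trans (sym X∉C) M∈C) λ ()

  Realised : ℕ → Set
  Realised d = ∃[ M ] ∃[ N ] (M ∈ C × N ∈ C × M ≢ N × Dist M N d)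

  minDist-exists : AtLeastTwo C → ∃ (MinDist C)
  minDist-exists (M , N , M∈C , N∈C , M≢N) with least Realised? (M , N , M∈C , N∈C , M≢N , proj₂ (dist-exists M N))
    where
    Realised? : ∀ d → Dec (Realised d)
    Realised? d = exhaustible-Matrix λ M → exhaustible-Matrix λ N →
      (M ∈C?) ×-dec (N ∈C?) ×-dec ¬? (M ≟M N) ×-dec dist-dec M N d
  ... | d , realised , smallest =
    d , realised , λ M N r M∈C N∈C M≢N dist → smallest r (M , N , M∈C , N∈C , M≢N , dist)

  minDist-unique : ∀ {d d'} → MinDist C d → MinDist C d' → d ≡ d'
  minDist-unique ((_ , _ , M∈C , N∈C , M≢N , dist) , smallest)
                 ((_ , _ , M'∈C , N'∈C , M'≢N' , dist') , smallest') =
    ℕ.≤-antisym (smallest _ _ _ M'∈C N'∈C M'≢N' dist') (smallest' _ _ _ M∈C N∈C M≢N dist)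

  Within : ℕ → Matrix → Set
  Within i X = ∃[ M ] ∃[ r ] (M ∈ C × Dist X M r × r ≤ i)

  Within-dec : ∀ i X → Dec (Within i X)
  Within-dec i X = exhaustible-Matrix λ M →
    map′ (λ (M∈C , r , dist , r≤i) → r , M∈C , dist , r≤i)
         (λ (r , M∈C , dist , r≤i) → M∈C , r , dist , r≤i)
         ((M ∈C?) ×-dec dist≤-dec X M i)

  -- Every matrix is within distance k of any fixed codeword, so ρ(C) ≤ k exists.
  covRad-exists : NonEmpty C → ∃ (CovRad C)
  covRad-exists (M , M∈C) = least (λ i → ∀-dec exhaustible-Matrix (Within-dec i)) covers-k
    where
    covers-k : Covers C k
    covers-k X with dist-exists X M
    ... | r , dist = M , r , M∈C , dist , rank≤k dist

  full⇒ρ≡0 : ∀ {ρ} → Full C → CovRad C ρ → ρ ≡ 0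
  full⇒ρ≡0 full (_ , smallest) = ℕ.n≤0⇒n≡0 (smallest 0 λ X → X , 0 , full X , dist-refl X , z≤n)

  full⇒d≡1 : ∀ {d} → 1 ≤ k → 1 ≤ m → Full C → MinDist C d → d ≡ 1
  full⇒d≡1 1≤k 1≤m full ((_ , _ , _ , _ , M≢N , dist) , smallest) with rank-one-pair 1≤k 1≤m
  ... | E , O , E≢O , dist≤1 with dist-exists E O
  ...   | r , distEO =
    ℕ.≤-antisym (ℕ.≤-trans (smallest E O r (full E) (full O) E≢O distEO) (dist≤1 distEO))
                (dist-positive M≢N dist)

  FarWord : ℕ → Matrix → Set
  FarWord ρ X = C X ≡ false × (∀ M r → M ∈ C → Dist X M r → ρ ≤ r)

  -- If C is not the whole space such a word exists for ρ = ρ(C): for ρ = 0 any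
  -- non-codeword will do, and for ρ = 1 + ρ' minimality of ρ yields a word not
  -- within ρ' of C.
  far-word : ∀ {ρ} → ¬ Full C → CovRad C ρ → ∃ (FarWord ρ)
  far-word {zero} not-full _ with exhaustible-Matrix (λ X → ¬? (X ∈C?))
  ... | yes (X , X∉C) = X , Bool.¬-not X∉C , λ _ _ _ _ → z≤n
  ... | no none = contradiction (λ X → decidable-stable (X ∈C?) λ X∉C → none (X , X∉C)) not-full
  far-word {suc ρ'} _ (_ , smallest) with exhaustible-Matrix (λ X → ¬? (Within-dec ρ' X))
  ... | no none = contradiction (smallest ρ' covers) ℕ.1+n≰n
    where
    covers : Covers C ρ'
    covers X = decidable-stable (Within-dec ρ' X) λ ¬within → none (X , ¬within)
  ... | yes (X , ¬within) = X , Bool.¬-not X∉C , far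
    where
    X∉C : ¬ X ∈ C
    X∉C X∈C = ¬within (X , 0 , X∈C , dist-refl X , z≤n)
    far : ∀ M r → M ∈ C → Dist X M r → suc ρ' ≤ r
    far M r M∈C dist = ℕ.≰⇒> λ r≤ρ' → ¬within (M , r , M∈C , dist , r≤ρ')

  module Extension (X : Matrix) where

    C∪X : Code
    C∪X Y = C Y ∨ does (Y ≟M X)

    C⊆C∪X : ∀ Y → Y ∈ C → Y ∈ C∪X
    C⊆C∪X Y Y∈C rewrite Y∈C = refl

    X∈C∪X : X ∈ C∪X
    X∈C∪X with C X | X ≟M X
    ... | true  | _ = refl
    ... | false | yes _ = refl
    ... | false | no X≢X = contradiction refl X≢X

    members : ∀ Y → Y ∈ C∪X → Y ∈ C ⊎ Y ≡ X
    members Y Y∈ with C Y | Y ≟M X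
    ... | true  | _ = inj₁ refl
    ... | false | yes Y≡X = inj₂ Y≡X
    ... | false | no _ = contradiction Y∈ λ ()

    proper : C X ≡ false → ProperSuperset C∪X C
    proper X∉C = C⊆C∪X , X , X∈C∪X , X∉C

    -- Adding a word far from C gives minimum distance min{ρ, d}: new pairs have
    -- distance ≥ ρ, with equality for X and its nearest codeword.
    extension-minDist : ∀ {d ρ} → MinDist C d → CovRad C ρ → FarWord ρ X → MinDist C∪X (ρ ⊓ d)
    extension-minDist {d} {ρ} ((M₀ , N₀ , M₀∈C , N₀∈C , M₀≢N₀ , dist₀) , smallest) (covers , _) (X∉C , far) =
      realised (ℕ.≤-total ρ d) , bound
      where
      realised : ρ ≤ d ⊎ d ≤ ρ → ∃[ M ] ∃[ N ] (M ∈ C∪X × N ∈ C∪X × M ≢ N × Dist M N (ρ ⊓ d))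
      realised (inj₁ ρ≤d) with covers X
      ... | M , r , M∈C , dist , r≤ρ =
        X , M , X∈C∪X , C⊆C∪X M M∈C , outside-distinct X∉C M∈C ,
        subst (Dist X M) (trans (ℕ.≤-antisym r≤ρ (far M r M∈C dist)) (sym (ℕ.m≤n⇒m⊓n≡m ρ≤d))) dist
      realised (inj₂ d≤ρ) =
        M₀ , N₀ , C⊆C∪X M₀ M₀∈C , C⊆C∪X N₀ N₀∈C , M₀≢N₀ , subst (Dist M₀ N₀) (sym (ℕ.m≥n⇒m⊓n≡n d≤ρ)) dist₀
      bound : ∀ M N r → M ∈ C∪X → N ∈ C∪X → M ≢ N → Dist M N r → ρ ⊓ d ≤ r
      bound M N r M∈ N∈ M≢N dist with members M M∈ | members N N∈
      ... | inj₁ M∈C  | inj₁ N∈C  = ℕ.≤-trans (ℕ.m⊓n≤n ρ d) (smallest M N r M∈C N∈C M≢N dist)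
      ... | inj₁ M∈C  | inj₂ refl = ℕ.≤-trans (ℕ.m⊓n≤m ρ d) (far M r M∈C (dist-sym dist))
      ... | inj₂ refl | inj₁ N∈C  = ℕ.≤-trans (ℕ.m⊓n≤m ρ d) (far N r N∈C dist)
      ... | inj₂ refl | inj₂ refl = contradiction refl M≢N

  -- Any proper superset D of C contains a word Y ∉ C, which is within ρ of some
  -- codeword, and contains a pair of codewords at distance d; so d(D) ≤ min{ρ, d}.
  superset-minDist : ∀ {D d ρ d'} → ProperSuperset D C → MinDist C d → CovRad C ρ → MinDist D d' → d' ≤ ρ ⊓ d
  superset-minDist (C⊆D , Y , Y∈D , Y∉C) ((M₀ , N₀ , M₀∈C , N₀∈C , M₀≢N₀ , dist₀) , _) (covers , _) (_ , smallest)
    with covers Y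
  ... | M , r , M∈C , dist , r≤ρ =
    ℕ.⊓-glb (ℕ.≤-trans (smallest Y M r Y∈D (C⊆D M M∈C) (outside-distinct Y∉C M∈C) dist) r≤ρ)
            (smallest M₀ N₀ _ (C⊆D M₀ M₀∈C) (C⊆D N₀ N₀∈C) M₀≢N₀ dist₀)

  full-dec : Dec (Full C)
  full-dec = ∀-dec exhaustible-Matrix _∈C?

  -- The main computation: μ(C) = d − min{ρ, d}.  For the whole space both sides
  -- are 1; otherwise the extension by a far word attains the bound of
  -- superset-minDist.
  maxDeg : ∀ {d ρ} → 1 ≤ k → 1 ≤ m → MinDist C d → CovRad C ρ → MaxDeg C (d ∸ (ρ ⊓ d))
  maxDeg 1≤k 1≤m minC covC with full-dec
  ... | yes full =
    inj₁ (full , cong₂ (λ d ρ → d ∸ (ρ ⊓ d)) (full⇒d≡1 1≤k 1≤m full minC) (full⇒ρ≡0 full covC))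
  maxDeg {d} {ρ} 1≤k 1≤m minC covC | no not-full with far-word not-full covC
  ... | X , far =
    inj₂ (not-full , (C∪X , d , ρ ⊓ d , proper (proj₁ far) , minC , extension-minDist minC covC far , refl) , optimal)
    where
    open Extension X
    optimal : ∀ D dC dD → ProperSuperset D C → MinDist C dC → MinDist D dD → d ∸ (ρ ⊓ d) ≤ dC ∸ dD
    optimal D dC dD D⊋C minC' minD rewrite minDist-unique minC' minC =
      ℕ.∸-monoʳ-≤ d (superset-minDist D⊋C minC covC minD)

  maximal-unextendable : ∀ {d} → Maximal C → MinDist C d → ∀ D → ProperSuperset D C → ¬ MinDist D d
  maximal-unextendable (inj₁ (_ , ¬two)) ((M , N , M∈C , N∈C , M≢N , _) , _) _ _ _ =
    ¬two (M , N , M∈C , N∈C , M≢N)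
  maximal-unextendable (inj₂ (_ , unextendable)) minC D D⊋C = unextendable D _ D⊋C minC

  -- For a maximal code ρ ≤ d: otherwise adding a far word keeps the distance d.
  maximal⇒ρ≤d : ∀ {d ρ} → Maximal C → MinDist C d → CovRad C ρ → ρ ≤ d
  maximal⇒ρ≤d {d} {ρ} maximal minC covC with ρ ℕ.≤? d
  ... | yes ρ≤d = ρ≤d
  ... | no ρ≰d with full-dec
  ...   | yes full = contradiction (subst (_≤ d) (sym (full⇒ρ≡0 full covC)) z≤n) ρ≰d
  ...   | no not-full with far-word not-full covC
  ...     | X , far = contradiction minC∪X (maximal-unextendable maximal minC C∪X (proper (proj₁ far)))
    where
    open Extension X
    minC∪X : MinDist C∪X d
    minC∪X = subst (MinDist C∪X) (ℕ.m≥n⇒m⊓n≡n (ℕ.<⇒≤ (ℕ.≰⇒> ρ≰d))) (extension-minDist minC covC far)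

proposition2p3 : (𝔽 : FiniteField) (k m : ℕ) → 1 ≤ k → k ≤ m →
    (C : Codes.Code 𝔽 k m) → Codes.AtLeastTwo 𝔽 k m C →
    ∃[ d ] ∃[ ρ ]
      (Codes.MinDist 𝔽 k m C d × Codes.CovRad 𝔽 k m C ρ ×
       Codes.MaxDeg 𝔽 k m C (d ∸ (ρ ⊓ d)) ×
       (Codes.Maximal 𝔽 k m C → Codes.MaxDeg 𝔽 k m C (d ∸ ρ)))
proposition2p3 𝔽 k m 1≤k k≤m C two@(M , _ , M∈C , _)
  with minDist-exists two | covRad-exists (M , M∈C)
  where open CodeFacts 𝔽 k m C
... | d , minC | ρ , covC = d , ρ , minC , covC , μ , μ-maximal
  where
  open Codes 𝔽 k m
  open CodeFacts 𝔽 k m C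
  1≤m : 1 ≤ m
  1≤m = ℕ.≤-trans 1≤k k≤m
  μ : MaxDeg C (d ∸ (ρ ⊓ d))
  μ = maxDeg 1≤k 1≤m minC covC
  μ-maximal : Maximal C → MaxDeg C (d ∸ ρ)
  μ-maximal maximal = subst (λ x → MaxDeg C (d ∸ x)) (ℕ.m≤n⇒m⊓n≡m (maximal⇒ρ≤d maximal minC covC)) μ
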